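{- Let $(U,V)$ be a proper equation and $\sigma$ a solution of it. Then there are at most $4n$ different pairs $ab$ of constants that are crossing in $\sigma$.
   Context: Let $n$ be the size of the original input instance. Constants come from a finite alphabet with involution $c\mapsto\overline c$ (extended to words by $\overline{c_1\cdots c_m}=\overline{c_m}\cdots\overline{c_1}$), variables from a finite set with fixed-point-free involution. A word equation $(U,V)$ (with constraints given by a map $\rho$ into a finite monoid with involution) is proper if $U$ and $V$ together contain at most $2cn^2$ occurrences of constants (for a fixed constant $c$, e.g. $c=27$), at most $n$ occurrences of variables, and there is a homomorphism $h$ from the alphabet of $(U,V)$ to $A^+$ ($A$ the original alphabet) with $\rho(b)=\rho(h(b))$. A solution is a homomorphism $\sigma$ fixing constants with $\sigma(U)=\sigma(V)$, $\sigma(\overline X)=\overline{\sigma(X)}$ (and satisfying the constraints). The $ab$-blocks are: if $a=b$, $a^i,\overline a^i$ ($i\ge2$); if $a\ne b$, $\overline a\ne a$, $\overline b\ne b$: $ab,\overline b\,\overline a$; if $a\ne b$, $\overline a=a$, $\overline b\ne b$: $ab,\overline ba,\overline bab$; if $a\ne b$, $\overline a\ne a$, $\overline b=b$: $ab,b\overline a,ab\overline a$; if $a\ne b$, $\overline a=a$, $\overline b=b$: $(ba)^i,a(ba)^i,(ba)^ib,(ab)^i$ ($i\ge1$). An occurrence of an $ab$-block in $\sigma(U)$ or $\sigma(V)$ is crossing if it comes neither entirely from constants of the equation nor entirely from $\sigma(X)$ for one occurrence of a variable $X$; $ab$ is crossing in $\sigma$ if some such occurrence is crossing. -}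

module Defs where

open import Data.Nat using (ℕ; zero; suc; _+_; _*_; _≤_)
open import Data.Fin using (Fin)
open import Data.List using (List; []; _∷_; _++_; map; reverse; replicate; concat; foldr; length)
open import Data.List.Relation.Unary.All using (All)
open import Data.List.Relation.Unary.Unique.Propositional using (Unique)
open import Data.List.Membership.Propositional using (_∈_)
open import Data.Maybe using (Maybe; just; nothing)
open import Data.Product using (_×_; _,_; proj₁; proj₂; Σ; ∃; ∃-syntax)
open import Data.Sum using (_⊎_; inj₁; inj₂)
open import Relation.Binary.PropositionalEquality using (_≡_; _≢_)
open import Relation.Nullary using (¬_)
open import Algebra.Structures using (IsMonoid)

record ConstAlphabet : Set where
  field
    size      : ℕ
    bar       : Fin size → Fin size
    bar-invol : ∀ a → bar (bar a) ≡ a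

  Const : Set
  Const = Fin size

  barW : List Const → List Const
  barW w = reverse (map bar w)

record VarSet : Set where
  field
    size      : ℕ
    bar       : Fin size → Fin size
    bar-invol : ∀ x → bar (bar x) ≡ x
    bar-nofix : ∀ x → bar x ≢ x

record FinInvMonoid : Set where
  field
    size         : ℕ
    _∙_          : Fin size → Fin size → Fin size
    ε            : Fin size
    isMonoid     : IsMonoid _≡_ _∙_ ε
    inv          : Fin size → Fin size
    inv-invol    : ∀ x → inv (inv x) ≡ x
    inv-antihom  : ∀ x y → inv (x ∙ y) ≡ (inv y ∙ inv x)

  Elt : Set
  Elt = Fin size

  evalW : {C : Set} → (C → Elt) → List C → Elt
  evalW f = foldr (λ c r → f c ∙ r) ε

module _ (A : ConstAlphabet) (Θ : VarSet) where
  open ConstAlphabet A using (Const; barW) renaming (bar to cbar)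

  Var : Set
  Var = Fin (VarSet.size Θ)

  vbar : Var → Var
  vbar = VarSet.bar Θ

  Sym : Set
  Sym = Const ⊎ Var

  countConsts : List Sym → ℕ
  countConsts []            = 0
  countConsts (inj₁ _ ∷ w) = suc (countConsts w)
  countConsts (inj₂ _ ∷ w) = countConsts w

  countVars : List Sym → ℕ
  countVars []            = 0
  countVars (inj₁ _ ∷ w) = countVars w
  countVars (inj₂ _ ∷ w) = suc (countVars w)

  applySub : (Var → List Const) → List Sym → List Const
  applySub σ []            = []
  applySub σ (inj₁ a ∷ w) = a ∷ applySub σ w
  applySub σ (inj₂ X ∷ w) = σ X ++ applySub σ w

  -- σ(W) with each letter labelled by its origin:
  --   nothing  = the letter is a constant of the equation,
  --   just j   = the letter comes from σ(X) for the variable occurrence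
  --              at position j of W.
  labelFrom : (Var → List Const) → ℕ → List Sym → List (Const × Maybe ℕ)
  labelFrom σ j []            = []
  labelFrom σ j (inj₁ a ∷ w) = (a , nothing) ∷ labelFrom σ (suc j) w
  labelFrom σ j (inj₂ X ∷ w) = map (λ a → (a , just j)) (σ X) ++ labelFrom σ (suc j) w

  labelled : (Var → List Const) → List Sym → List (Const × Maybe ℕ)
  labelled σ = labelFrom σ 0

  record Proper (n c : ℕ) (M : FinInvMonoid)
                (A₀ : ConstAlphabet)
                (ρ₀ : ConstAlphabet.Const A₀ → FinInvMonoid.Elt M)
                (ρc : Const → FinInvMonoid.Elt M)
                (U V : List Sym) : Set where
    field
      constBound : countConsts U + countConsts V ≤ 2 * c * n * n
      varBound   : countVars U + countVars V ≤ n
      hom        : Const → List (ConstAlphabet.Const A₀)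
      hom-nonempty : ∀ b → (inj₁ b ∈ U ⊎ inj₁ b ∈ V) → hom b ≢ []
      hom-ρ        : ∀ b → (inj₁ b ∈ U ⊎ inj₁ b ∈ V) →
                     ρc b ≡ FinInvMonoid.evalW M ρ₀ (hom b)

  record Solution (M : FinInvMonoid)
                  (ρc : Const → FinInvMonoid.Elt M)
                  (ρv : Var → FinInvMonoid.Elt M)
                  (U V : List Sym) (σ : Var → List Const) : Set where
    field
      solves      : applySub σ U ≡ applySub σ V
      respects-bar : ∀ X → σ (vbar X) ≡ barW (σ X)
      constraint  : ∀ X → FinInvMonoid.evalW M ρc (σ X) ≡ ρv X

  CrossingOcc : List Const → List (Const × Maybe ℕ) → Set
  CrossingOcc w L =
    Σ (List (Const × Maybe ℕ)) λ p → Σ (List (Const × Maybe ℕ)) λ q →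
    Σ (List (Const × Maybe ℕ)) λ s →
      (L ≡ p ++ q ++ s) × (map proj₁ q ≡ w)
      × ¬ All (λ t → proj₂ t ≡ nothing) q
      × ¬ (∃[ j ] All (λ t → proj₂ t ≡ just j) q)

module _ (A : ConstAlphabet) where
  open ConstAlphabet A

  pw : Const → Const → ℕ → List Const
  pw x y i = concat (replicate i (x ∷ y ∷ []))

  data IsBlock (a b : Const) : List Const → Set where
    pow    : a ≡ b → ∀ i → 2 ≤ i → IsBlock a b (replicate i a)
    powbar : a ≡ b → ∀ i → 2 ≤ i → IsBlock a b (replicate i (bar a))
    nn₁ : a ≢ b → bar a ≢ a → bar b ≢ b → IsBlock a b (a ∷ b ∷ [])
    nn₂ : a ≢ b → bar a ≢ a → bar b ≢ b → IsBlock a b (bar b ∷ bar a ∷ [])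
    fn₁ : a ≢ b → bar a ≡ a → bar b ≢ b → IsBlock a b (a ∷ b ∷ [])
    fn₂ : a ≢ b → bar a ≡ a → bar b ≢ b → IsBlock a b (bar b ∷ a ∷ [])
    fn₃ : a ≢ b → bar a ≡ a → bar b ≢ b → IsBlock a b (bar b ∷ a ∷ b ∷ [])
    nf₁ : a ≢ b → bar a ≢ a → bar b ≡ b → IsBlock a b (a ∷ b ∷ [])
    nf₂ : a ≢ b → bar a ≢ a → bar b ≡ b → IsBlock a b (b ∷ bar a ∷ [])
    nf₃ : a ≢ b → bar a ≢ a → bar b ≡ b → IsBlock a b (a ∷ b ∷ bar a ∷ [])
    ff₁ : a ≢ b → bar a ≡ a → bar b ≡ b → ∀ i → 1 ≤ i → IsBlock a b (pw b a i)
    ff₂ : a ≢ b → bar a ≡ a → bar b ≡ b → ∀ i → 1 ≤ i → IsBlock a b (a ∷ pw b a i)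
    ff₃ : a ≢ b → bar a ≡ a → bar b ≡ b → ∀ i → 1 ≤ i → IsBlock a b (pw b a i ++ b ∷ [])
    ff₄ : a ≢ b → bar a ≡ a → bar b ≡ b → ∀ i → 1 ≤ i → IsBlock a b (pw a b i)

CrossingPair : (A : ConstAlphabet) (Θ : VarSet) (U V : List (Sym A Θ))
               (σ : Var A Θ → List (ConstAlphabet.Const A))
               (a b : ConstAlphabet.Const A) → Set
CrossingPair A Θ U V σ a b =
  Σ (List (ConstAlphabet.Const A)) λ w → IsBlock A a b w ×
    (CrossingOcc A Θ w (labelled A Θ σ U) ⊎ CrossingOcc A Θ w (labelled A Θ σ V))

-- Label every letter of σ(W) by its origin (a constant of the equation, or
-- the occurrence of a variable it comes from) and call a pair of consecutive
-- letters with different labels a boundary of the labelled word.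
--
--  * Counting: letters coming from constants all carry the same label and a
--    variable occurrence contributes one run of equal labels, so σ(U) and
--    σ(V) together have at most 2·(#variable occurrences) ≤ 2n boundaries.
--  * Locating: a crossing occurrence of a word mixes labels, hence contains
--    a boundary; so a crossing ab-block has two consecutive letters xy that
--    form a boundary of σ(U) or σ(V).
--  * Decoding: every two-letter factor xy of an ab-block is ab or its
--    involution b̄ā, so ab is xy or ȳx̄.
--
-- Hence every crossing pair lies in a list of length 2·2n built from the
-- boundaries, and a duplicate-free list of crossing pairs has length ≤ 4n.
module Submission where

open import Defs
open import Data.Nat using (ℕ; zero; suc; _+_; _*_; _≤_; z≤n; s≤s)
open import Data.Nat.Properties
  using (≤-refl; ≤-reflexive; ≤-trans; n≤1+n; +-mono-≤; *-monoʳ-≤; *-suc; *-distribˡ-+; *-distribʳ-+; module ≤-Reasoning)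
  renaming (_≟_ to _≟ℕ_)
open import Data.List using (List; []; _∷_; _++_; map; length; replicate)
open import Data.List.Properties using (length-++; length-map; length-++-≤ʳ; length-removeAt′)
open import Data.List.Relation.Unary.All as All using (All; []; _∷_)
open import Data.List.Relation.Unary.Any using (here; there; index; _─_)
open import Data.List.Relation.Unary.Unique.Propositional using (Unique)
open import Data.List.Relation.Unary.AllPairs using (_∷_)
open import Data.List.Membership.Propositional using (_∈_)
open import Data.List.Membership.Propositional.Properties using (∈-++⁺ˡ; ∈-++⁺ʳ; ∈-map⁺)
open import Data.List.Relation.Binary.Subset.Propositional using (_⊆_)
open import Data.List.Relation.Binary.Subset.Propositional.Properties using (++⁺ʳ; xs⊆ys++xs)
open import Data.Maybe using (Maybe; just; nothing)
open import Data.Maybe.Properties using (≡-dec)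
open import Data.Product using (_×_; _,_; proj₁; proj₂; ∃₂)
open import Data.Sum using (_⊎_; inj₁; inj₂; swap)
open import Relation.Binary.Definitions using (DecidableEquality)
open import Relation.Nullary using (¬_; yes; no; contradiction)
open import Relation.Binary.PropositionalEquality
  using (_≡_; _≢_; refl; sym; trans; cong; cong₂; subst; ≢-sym)

∈-─ : {X : Set} {x y : X} {xs : List X} (x∈xs : x ∈ xs) → y ∈ xs → y ≢ x → y ∈ (xs ─ x∈xs)
∈-─ (here refl) (here refl) y≢x = contradiction refl y≢x
∈-─ (here _)    (there y∈xs) _  = y∈xs
∈-─ (there _)   (here refl)  _  = here refl
∈-─ (there x∈xs) (there y∈xs) y≢x = there (∈-─ x∈xs y∈xs y≢x)

unique-⊆-length : {X : Set} {xs ys : List X} → Unique xs → xs ⊆ ys → length xs ≤ length ys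
unique-⊆-length {xs = []} _ _ = z≤n
unique-⊆-length {xs = x ∷ xs} {ys} (x∉xs ∷ xs-unique) xs⊆ys = begin
  suc (length xs)          ≤⟨ s≤s (unique-⊆-length xs-unique xs⊆rest) ⟩
  suc (length (ys ─ x∈ys)) ≡⟨ sym (length-removeAt′ ys (index x∈ys)) ⟩
  length ys                ∎
  where
  open ≤-Reasoning
  x∈ys : x ∈ ys
  x∈ys = xs⊆ys (here refl)
  xs⊆rest : xs ⊆ (ys ─ x∈ys)
  xs⊆rest y∈xs = ∈-─ x∈ys (xs⊆ys (there y∈xs)) (≢-sym (All.lookup x∉xs y∈xs))

data Adjacent {X : Set} (x y : X) : List X → Set where
  here  : {w : List X} → Adjacent x y (x ∷ y ∷ w)
  there : {z : X} {w : List X} → Adjacent x y w → Adjacent x y (z ∷ w)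

module Boundaries {Label : Set} (_≟ᴸ_ : DecidableEquality Label) where

  edge : {C : Set} → C × Label → C × Label → List (C × C)
  edge s t with proj₂ s ≟ᴸ proj₂ t
  ... | yes _ = []
  ... | no _  = (proj₁ s , proj₁ t) ∷ []

  boundaries : {C : Set} → List (C × Label) → List (C × C)
  boundaries []          = []
  boundaries (_ ∷ [])    = []
  boundaries (s ∷ t ∷ w) = edge s t ++ boundaries (t ∷ w)

  edge-length : {C : Set} (s t : C × Label) → length (edge s t) ≤ 1
  edge-length s t with proj₂ s ≟ᴸ proj₂ t
  ... | yes _ = z≤n
  ... | no _  = s≤s z≤n

  edge-same : {C : Set} (s t : C × Label) → proj₂ s ≡ proj₂ t → edge s t ≡ []
  edge-same s t same with proj₂ s ≟ᴸ proj₂ t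
  ... | yes _     = refl
  ... | no differ = contradiction same differ

  boundaries-cons-≤ : {C : Set} (s : C × Label) (w : List (C × Label)) →
                      length (boundaries (s ∷ w)) ≤ suc (length (boundaries w))
  boundaries-cons-≤ s []      = z≤n
  boundaries-cons-≤ s (t ∷ w) =
    ≤-trans (≤-reflexive (length-++ (edge s t))) (+-mono-≤ (edge-length s t) ≤-refl)

  boundaries-cons-≥ : {C : Set} (s : C × Label) (w : List (C × Label)) →
                      length (boundaries w) ≤ length (boundaries (s ∷ w))
  boundaries-cons-≥ s []      = z≤n
  boundaries-cons-≥ s (t ∷ w) = length-++-≤ʳ (boundaries (t ∷ w)) {edge s t}

  boundaries-⊆-cons : {C : Set} (s : C × Label) (w : List (C × Label)) → boundaries w ⊆ boundaries (s ∷ w)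
  boundaries-⊆-cons s []      ()
  boundaries-⊆-cons s (t ∷ w) = xs⊆ys++xs _ (edge s t)

  boundaries-⊆-prefix : {C : Set} (q s : List (C × Label)) → boundaries q ⊆ boundaries (q ++ s)
  boundaries-⊆-prefix []          s ()
  boundaries-⊆-prefix (_ ∷ [])    s ()
  boundaries-⊆-prefix (t ∷ u ∷ q) s = ++⁺ʳ (edge t u) (boundaries-⊆-prefix (u ∷ q) s)

  boundaries-⊆-suffix : {C : Set} (p w : List (C × Label)) → boundaries w ⊆ boundaries (p ++ w)
  boundaries-⊆-suffix []      w = λ b → b
  boundaries-⊆-suffix (t ∷ p) w = λ b → boundaries-⊆-cons t (p ++ w) (boundaries-⊆-suffix p w b)

  boundaries-⊆-infix : {C : Set} (p q s : List (C × Label)) → boundaries q ⊆ boundaries (p ++ q ++ s)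
  boundaries-⊆-infix p q s b = boundaries-⊆-suffix p (q ++ s) (boundaries-⊆-prefix q s b)

  boundaries-run : {C : Set} (l : Label) (x : C) (xs : List C) (w : List (C × Label)) →
                   length (boundaries ((x , l) ∷ map (_, l) xs ++ w)) ≤ suc (length (boundaries w))
  boundaries-run l x []       w = boundaries-cons-≤ (x , l) w
  boundaries-run l x (y ∷ ys) w rewrite edge-same (x , l) (y , l) refl = boundaries-run l y ys w

  boundaries-unsentinel : {C : Set} (l : Label) (w : List (C × Label)) (k : ℕ) →
                          (∀ c → length (boundaries ((c , l) ∷ w)) ≤ k) → length (boundaries w) ≤ k
  boundaries-unsentinel l []      k bound = z≤n
  boundaries-unsentinel l (t ∷ w) k bound = ≤-trans (boundaries-cons-≥ (proj₁ t , l) (t ∷ w)) (bound (proj₁ t))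

  Unlabelled : {C : Set} → List (C × Label) → Set
  Unlabelled q = ∀ l → ¬ All (λ t → proj₂ t ≡ l) q

  unlabelled-boundary : {C : Set} (t : C × Label) (q : List (C × Label)) → Unlabelled (t ∷ q) →
                        ∃₂ λ x y → (x , y) ∈ boundaries (t ∷ q) × Adjacent x y (map proj₁ (t ∷ q))
  unlabelled-boundary t [] mixed = contradiction (refl ∷ []) (mixed (proj₂ t))
  unlabelled-boundary t (u ∷ q) mixed with proj₂ t ≟ᴸ proj₂ u
  ... | no _ = proj₁ t , proj₁ u , here refl , here
  ... | yes same with unlabelled-boundary u q (λ l all → mixed l (trans same (All.head all) ∷ all))
  ...   | x , y , xy∈ , xy-adj = x , y , xy∈ , there xy-adj

open Boundaries (≡-dec _≟ℕ_)

module Labelling (A : ConstAlphabet) (Θ : VarSet) (σ : Var A Θ → List (ConstAlphabet.Const A)) where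
  open ConstAlphabet A using (Const)

  -- Behind a letter labelled as a constant, each variable occurrence of W
  -- contributes at most two boundaries: on entering and on leaving σ(X).
  labelFrom-boundaries : (c : Const) (j : ℕ) (W : List (Sym A Θ)) →
    length (boundaries ((c , nothing) ∷ labelFrom A Θ σ j W)) ≤ 2 * countVars A Θ W
  labelFrom-boundaries c j [] = z≤n
  labelFrom-boundaries c j (inj₁ b ∷ W)
    rewrite edge-same (c , nothing) (b , nothing) refl = labelFrom-boundaries b (suc j) W
  labelFrom-boundaries c j (inj₂ X ∷ W) with σ X
  ... | [] = ≤-trans (labelFrom-boundaries c (suc j) W) (*-monoʳ-≤ 2 (n≤1+n _))
  ... | x ∷ xs = begin
    length (boundaries ((c , nothing) ∷ (x , just j) ∷ map (_, just j) xs ++ L))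
      ≤⟨ boundaries-cons-≤ (c , nothing) ((x , just j) ∷ map (_, just j) xs ++ L) ⟩
    suc (length (boundaries ((x , just j) ∷ map (_, just j) xs ++ L)))
      ≤⟨ s≤s (boundaries-run (just j) x xs L) ⟩
    2 + length (boundaries L)
      ≤⟨ s≤s (s≤s (boundaries-cons-≥ (c , nothing) L)) ⟩
    2 + length (boundaries ((c , nothing) ∷ L))
      ≤⟨ s≤s (s≤s (labelFrom-boundaries c (suc j) W)) ⟩
    2 + 2 * countVars A Θ W
      ≡⟨ sym (*-suc 2 (countVars A Θ W)) ⟩
    2 * suc (countVars A Θ W) ∎
    where
    open ≤-Reasoning
    L : List (Const × Maybe ℕ)
    L = labelFrom A Θ σ (suc j) W

  labelled-boundaries : (W : List (Sym A Θ)) →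
    length (boundaries (labelled A Θ σ W)) ≤ 2 * countVars A Θ W
  labelled-boundaries W =
    boundaries-unsentinel nothing (labelled A Θ σ W) _ (λ c → labelFrom-boundaries c 0 W)

  crossing-boundary : (w : List Const) (L : List (Const × Maybe ℕ)) → CrossingOcc A Θ w L →
                      ∃₂ λ x y → (x , y) ∈ boundaries L × Adjacent x y w
  crossing-boundary w L (p , [] , s , _ , _ , not-constants , _) = contradiction [] not-constants
  crossing-boundary w L (p , t ∷ q , s , refl , refl , not-constants , not-variable)
    with unlabelled-boundary t q mixed
    where
    mixed : Unlabelled (t ∷ q)
    mixed nothing  = not-constants
    mixed (just j) = λ all → not-variable (j , all)
  ... | x , y , xy∈ , xy-adj = x , y , boundaries-⊆-infix p (t ∷ q) s xy∈ , xy-adj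

module Blocks (A : ConstAlphabet) where
  open ConstAlphabet A

  mirror : Const × Const → Const × Const
  mirror (x , y) = (bar y , bar x)

  mirror-involutive : (p : Const × Const) → mirror (mirror p) ≡ p
  mirror-involutive (x , y) = cong₂ _,_ (bar-invol x) (bar-invol y)

  alternating : Const → Const → ℕ → List Const
  alternating x y zero    = []
  alternating x y (suc k) = x ∷ alternating y x k

  pw-alternating : (x y : Const) (i : ℕ) → pw A x y i ≡ alternating x y (i * 2)
  pw-alternating x y zero    = refl
  pw-alternating x y (suc i) = cong (λ w → x ∷ y ∷ w) (pw-alternating x y i)

  pw-snoc-alternating : (x y : Const) (i : ℕ) → pw A x y i ++ x ∷ [] ≡ alternating x y (suc (i * 2))
  pw-snoc-alternating x y zero    = refl
  pw-snoc-alternating x y (suc i) = cong (λ w → x ∷ y ∷ w) (pw-snoc-alternating x y i)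

  alternating-factor : {x y a b : Const} {w : List Const} (k : ℕ) → w ≡ alternating a b k →
                       Adjacent x y w → (x , y) ≡ (a , b) ⊎ (x , y) ≡ (b , a)
  alternating-factor (suc (suc k)) refl here       = inj₁ refl
  alternating-factor (suc k)       refl (there xy) = swap (alternating-factor k refl xy)

  replicate-factor : {x y z : Const} (i : ℕ) → Adjacent x y (replicate i z) → (x , y) ≡ (z , z)
  replicate-factor (suc (suc i)) here       = refl
  replicate-factor (suc i)       (there xy) = replicate-factor i xy

  pair-factor : {x y u v : Const} → Adjacent x y (u ∷ v ∷ []) → (x , y) ≡ (u , v)
  pair-factor here                  = refl
  pair-factor (there (there ()))

  triple-factor : {x y u v w : Const} → Adjacent x y (u ∷ v ∷ w ∷ []) → (x , y) ≡ (u , v) ⊎ (x , y) ≡ (v , w)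
  triple-factor here                   = inj₁ refl
  triple-factor (there here)           = inj₂ refl
  triple-factor (there (there (there ())))

  AbFactor : Const → Const → Const → Const → Set
  AbFactor a b x y = (x , y) ≡ (a , b) ⊎ (x , y) ≡ mirror (a , b)

  -- For self-involutive a and b the word ba is the involution of ab.
  fixed-factor : {a b x y : Const} → bar a ≡ a → bar b ≡ b →
                 (x , y) ≡ (a , b) ⊎ (x , y) ≡ (b , a) → AbFactor a b x y
  fixed-factor fa fb (inj₁ xy≡ab) = inj₁ xy≡ab
  fixed-factor fa fb (inj₂ xy≡ba) = inj₂ (trans xy≡ba (cong₂ _,_ (sym fb) (sym fa)))

  block-factor : {a b x y : Const} {w : List Const} → IsBlock A a b w → Adjacent x y w → AbFactor a b x y
  block-factor (pow refl i _)    xy = inj₁ (replicate-factor i xy)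
  block-factor (powbar refl i _) xy = inj₂ (replicate-factor i xy)
  block-factor (nn₁ _ _ _)       xy = inj₁ (pair-factor xy)
  block-factor (nn₂ _ _ _)       xy = inj₂ (pair-factor xy)
  block-factor (fn₁ _ _ _)       xy = inj₁ (pair-factor xy)
  block-factor {b = b} (fn₂ _ fa _) xy = inj₂ (trans (pair-factor xy) (cong (bar b ,_) (sym fa)))
  block-factor {b = b} (fn₃ _ fa _) xy with triple-factor xy
  ... | inj₁ xy≡b̄a = inj₂ (trans xy≡b̄a (cong (bar b ,_) (sym fa)))
  ... | inj₂ xy≡ab = inj₁ xy≡ab
  block-factor (nf₁ _ _ _)       xy = inj₁ (pair-factor xy)
  block-factor {a = a} (nf₂ _ _ fb) xy = inj₂ (trans (pair-factor xy) (cong (_, bar a) (sym fb)))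
  block-factor {a = a} (nf₃ _ _ fb) xy with triple-factor xy
  ... | inj₁ xy≡ab = inj₁ xy≡ab
  ... | inj₂ xy≡bā = inj₂ (trans xy≡bā (cong (_, bar a) (sym fb)))
  block-factor {a} {b} (ff₁ _ fa fb i _) xy =
    fixed-factor fa fb (swap (alternating-factor (i * 2) (pw-alternating b a i) xy))
  block-factor {a} {b} (ff₂ _ fa fb i _) xy =
    fixed-factor fa fb (alternating-factor (suc (i * 2)) (cong (a ∷_) (pw-alternating b a i)) xy)
  block-factor {a} {b} (ff₃ _ fa fb i _) xy =
    fixed-factor fa fb (swap (alternating-factor (suc (i * 2)) (pw-snoc-alternating b a i) xy))
  block-factor {a} {b} (ff₄ _ fa fb i _) xy =
    fixed-factor fa fb (alternating-factor (i * 2) (pw-alternating a b i) xy)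

  candidates : List (Const × Const) → List (Const × Const)
  candidates es = es ++ map mirror es

  candidates-length : (es : List (Const × Const)) → length (candidates es) ≡ length es + length es
  candidates-length es = trans (length-++ es) (cong (length es +_) (length-map mirror es))

  factor-candidate : {a b x y : Const} {es : List (Const × Const)} →
                     (x , y) ∈ es → AbFactor a b x y → (a , b) ∈ candidates es
  factor-candidate xy∈es (inj₁ refl) = ∈-++⁺ˡ xy∈es
  factor-candidate {a} {b} {x} {y} {es} xy∈es (inj₂ xy≡b̄ā) =
    ∈-++⁺ʳ es (subst (_∈ map mirror es) mirror-xy≡ab (∈-map⁺ mirror xy∈es))
    where
    mirror-xy≡ab : mirror (x , y) ≡ (a , b)
    mirror-xy≡ab = trans (cong mirror xy≡b̄ā) (mirror-involutive (a , b))

module CrossingPairs (A : ConstAlphabet) (Θ : VarSet) (σ : Var A Θ → List (ConstAlphabet.Const A))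
                     (U V : List (Sym A Θ)) where
  open ConstAlphabet A using (Const)
  open Labelling A Θ σ
  open Blocks A

  solutionBoundaries : List (Const × Const)
  solutionBoundaries = boundaries (labelled A Θ σ U) ++ boundaries (labelled A Θ σ V)

  solutionBoundaries-length : length solutionBoundaries ≤ 2 * (countVars A Θ U + countVars A Θ V)
  solutionBoundaries-length = begin
    length solutionBoundaries
      ≡⟨ length-++ (boundaries (labelled A Θ σ U)) ⟩
    length (boundaries (labelled A Θ σ U)) + length (boundaries (labelled A Θ σ V))
      ≤⟨ +-mono-≤ (labelled-boundaries U) (labelled-boundaries V) ⟩
    2 * countVars A Θ U + 2 * countVars A Θ V
      ≡⟨ sym (*-distribˡ-+ 2 (countVars A Θ U) (countVars A Θ V)) ⟩
    2 * (countVars A Θ U + countVars A Θ V) ∎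
    where open ≤-Reasoning

  crossing-candidate : {a b : Const} → CrossingPair A Θ U V σ a b → (a , b) ∈ candidates solutionBoundaries
  crossing-candidate (w , block , inj₁ occ) with crossing-boundary w _ occ
  ... | _ , _ , xy∈ , xy = factor-candidate (∈-++⁺ˡ xy∈) (block-factor block xy)
  crossing-candidate (w , block , inj₂ occ) with crossing-boundary w _ occ
  ... | _ , _ , xy∈ , xy =
    factor-candidate (∈-++⁺ʳ (boundaries (labelled A Θ σ U)) xy∈) (block-factor block xy)

mainTheorem8 : (n c : ℕ) (A : ConstAlphabet) (Θ : VarSet) (M : FinInvMonoid)
    (A₀ : ConstAlphabet) (ρ₀ : ConstAlphabet.Const A₀ → FinInvMonoid.Elt M)
    (ρc : ConstAlphabet.Const A → FinInvMonoid.Elt M)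
    (ρv : Var A Θ → FinInvMonoid.Elt M)
    (U V : List (Sym A Θ)) (σ : Var A Θ → List (ConstAlphabet.Const A)) →
    Proper A Θ n c M A₀ ρ₀ ρc U V →
    Solution A Θ M ρc ρv U V σ →
    (ps : List (ConstAlphabet.Const A × ConstAlphabet.Const A)) →
    Unique ps →
    All (λ p → CrossingPair A Θ U V σ (proj₁ p) (proj₂ p)) ps →
    length ps ≤ 4 * n
mainTheorem8 n c A Θ M A₀ ρ₀ ρc ρv U V σ proper _ ps unique crossing = begin
  length ps                         ≤⟨ unique-⊆-length unique ps⊆candidates ⟩
  length (candidates es)            ≡⟨ candidates-length es ⟩
  length es + length es             ≤⟨ +-mono-≤ es≤2n es≤2n ⟩
  2 * n + 2 * n                     ≡⟨ sym (*-distribʳ-+ n 2 2) ⟩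
  4 * n                             ∎
  where
  open ≤-Reasoning
  open Blocks A using (candidates; candidates-length)
  open CrossingPairs A Θ σ U V
  es : List (ConstAlphabet.Const A × ConstAlphabet.Const A)
  es = solutionBoundaries
  es≤2n : length es ≤ 2 * n
  es≤2n = ≤-trans solutionBoundaries-length (*-monoʳ-≤ 2 (Proper.varBound proper))
  ps⊆candidates : ps ⊆ candidates es
  ps⊆candidates p∈ps = crossing-candidate (All.lookup crossing p∈ps)
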